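{- Let $S$ be a nonempty subset of $\{A,B,C,D\}$, let $P$ be an $S$-order, and let $\mathcal T: x_0,x_1,\dots,x_t$ be a forcing trail in $P$. Fix an $S$-representation of $P$ in which all intervals have length $2$. Then for $0\le i\le t$: (i) $c(x_i)\ge c(x_0)+val_{\mathcal T}(x_i)$; and (ii) if $c(x_i)>c(x_0)+val_{\mathcal T}(x_i)$ for some $i$, then $c(x_j)>c(x_0)+val_{\mathcal T}(x_j)$ for all $j\ge i$ (with $j\le t$).
   Context: Interval types: every interval $I_v$ has left endpoint $L(v)$, right endpoint $R(v)$, center $c(v)=(L(v)+R(v))/2$, and one of four types: $A$ (endpoints closed, center closed), $B$ (endpoints open, center open), $C$ (endpoints closed, center open), $D$ (endpoints open, center closed); the center always belongs to the interval. For nonempty $S\subseteq\{A,B,C,D\}$, an $S$-representation of a poset $(X,\prec)$ assigns to each $x\in X$ an interval $I_x$, all of the same positive length, each of type in $S$, such that $x\prec y$ iff (i) $R(x)<c(y)$, or (ii) $R(x)=c(y)$, at least one of $R(x),c(y)$ is open, and at least one of $L(y),c(x)$ is open. An $S$-order is a poset with an $S$-representation. For distinct elements, $x\parallel y$ means $x$ and $y$ are incomparable. A forcing trail $\mathcal T$ is a sequence $x_0,\dots,x_t$ of elements such that for each $0\le i\le t-1$, either $x_i\prec x_{i+1}$ or $x_i\parallel x_{i+1}$. Define $up_{\mathcal T}(x_i)=|\{j:0\le j\le i-1,\ x_j\prec x_{j+1}\}|$, $side_{\mathcal T}(x_i)=|\{j:0\le j\le i-1,\ x_j\parallel x_{j+1}\}|$,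 and $val_{\mathcal T}(x_i)=up_{\mathcal T}(x_i)-side_{\mathcal T}(x_i)$. -}

module Defs where

open import Level using (0ℓ)
open import Data.Nat using (ℕ; zero; suc)
open import Data.Integer using (ℤ; +_; -[1+_])
open import Data.Fin using (Fin; zero; suc)
open import Data.Bool using (Bool; true; false; _∨_)
open import Data.Product using (Σ; _×_; _,_)
open import Data.Sum using (_⊎_)
open import Relation.Nullary using (¬_)
open import Relation.Binary.PropositionalEquality using (_≡_; _≢_)
open import Relation.Binary.Structures using (IsStrictTotalOrder; IsStrictPartialOrder)
open import Algebra.Structures using (IsCommutativeRing)

-- The real line, axiomatised as an ordered field (the stdlib has no ℝ).
-- Every result proved over an arbitrary ordered field holds for ℝ.

record OrderedField : Set₁ where
  infixl 6 _+_
  infixl 7 _*_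
  infix  4 _<_ _≤_
  field
    Carrier : Set
    _+_ _*_ : Carrier → Carrier → Carrier
    -_      : Carrier → Carrier
    0# 1#   : Carrier
    _<_     : Carrier → Carrier → Set
    isCommutativeRing : IsCommutativeRing _≡_ _+_ _*_ -_ 0# 1#
    isStrictTotalOrder : IsStrictTotalOrder _≡_ _<_
    +-mono-< : ∀ {a b} c → a < b → a + c < b + c
    *-pos    : ∀ {a b} → 0# < a → 0# < b → 0# < a * b
    0<1      : 0# < 1#
    inverse  : ∀ a → a ≢ 0# → Σ Carrier (λ b → a * b ≡ 1#)

  _-_ : Carrier → Carrier → Carrier
  a - b = a + (- b)

  _≤_ : Carrier → Carrier → Set
  a ≤ b = (a < b) ⊎ (a ≡ b)

  fromℕ : ℕ → Carrier
  fromℕ zero    = 0#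
  fromℕ (suc n) = fromℕ n + 1#

  fromℤ : ℤ → Carrier
  fromℤ (+ n)    = fromℕ n
  fromℤ -[1+ n ] = - (fromℕ (suc n))

data IType : Set where
  A B C D : IType

endOpen : IType → Bool
endOpen A = false
endOpen B = true
endOpen C = false
endOpen D = true

cenOpen : IType → Bool
cenOpen A = false
cenOpen B = true
cenOpen C = true
cenOpen D = false

Types : Set
Types = IType → Bool

Nonempty : Types → Set
Nonempty S = Σ IType (λ τ → S τ ≡ true)

-- interval with center m, length 2, type τ: L = m - 1, R = m + 1.
-- "x before y" for intervals (cx, τx), (cy, τy):
--   R(x) < c(y), or R(x) = c(y) with (R(x) or c(y) open) and (L(y) or c(x) open).
Before2 : (F : OrderedField) → OrderedField.Carrier F → IType →
          OrderedField.Carrier F → IType → Set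
Before2 F cx τx cy τy =
    (Rx < cy)
    ⊎ ((Rx ≡ cy)
       × (endOpen τx ∨ cenOpen τy) ≡ true
       × (endOpen τy ∨ cenOpen τx) ≡ true)
  where
    open OrderedField F
    Rx = cx + 1#

record Rep2 (F : OrderedField) (S : Types) {X : Set} (_≺_ : X → X → Set) : Set where
  open OrderedField F
  field
    c    : X → Carrier
    type : X → IType
    type∈S : ∀ x → S (type x) ≡ true
    represents : ∀ x y → (x ≺ y → Before2 F (c x) (type x) (c y) (type y))
                         × (Before2 F (c x) (type x) (c y) (type y) → x ≺ y)

  L R : X → Carrier
  L x = c x - 1#
  R x = c x + 1#

Incomp : {X : Set} → (X → X → Set) → X → X → Set
Incomp _≺_ x y = (x ≢ y) × ¬ (x ≺ y) × ¬ (y ≺ x)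

data Step {X : Set} (_≺_ : X → X → Set) (x y : X) : Set where
  up   : x ≺ y → Step _≺_ x y
  side : Incomp _≺_ x y → Step _≺_ x y

-- number of indices j < i whose weight is counted (sum of the first i weights)
prefixCount : {t : ℕ} → (Fin t → ℕ) → Fin (suc t) → ℕ
prefixCount w zero = 0
prefixCount {suc t} w (suc i) = w zero Data.Nat.+ prefixCount (λ j → w (suc j)) i

record Trail {X : Set} (_≺_ : X → X → Set) (t : ℕ) : Set where
  field
    x    : Fin (suc t) → X
    step : (i : Fin t) → Step _≺_ (x (Data.Fin.inject₁ i)) (x (suc i))

  isUp : Fin t → ℕ
  isUp i with step i
  ... | up _   = 1
  ... | side _ = 0

  isSide : Fin t → ℕ
  isSide i with step i
  ... | up _   = 0
  ... | side _ = 1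

  upT side' : Fin (suc t) → ℕ
  upT   = prefixCount isUp
  side' = prefixCount isSide

  val : Fin (suc t) → ℤ
  val i = (+ upT i) Data.Integer.- (+ side' i)

-- With all intervals of length 2, R(x) = c(x) + 1.  An up-step x ≺ y forces
-- c(y) ≥ R(x) = c(x) + 1, and a side-step x ∥ y forces c(y) ≥ c(x) − 1, since
-- R(y) < c(x) would give y ≺ x.  As val rises by exactly 1 on up-steps and drops
-- by exactly 1 on side-steps, c(x_i) − c(x_0) − val(x_i) is nondecreasing along
-- the trail.  It is 0 at i = 0, which gives (i), and once positive it stays
-- positive, which gives (ii).
module Submission where

open import Defs
open import Data.Nat using (ℕ)
open import Data.Fin using (Fin; zero; toℕ)
open import Data.Product using (_×_)
open import Relation.Binary.PropositionalEquality using (_≡_)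
open import Relation.Binary.Structures using (IsStrictPartialOrder)

open import Level using (0ℓ)
import Data.Nat as ℕ
import Data.Nat.Properties as ℕ
open import Data.Integer as ℤ using (_⊖_)
import Data.Integer.Properties as ℤ
open import Data.Fin using (suc; inject₁)
open import Data.Fin.Induction using (<-weakInduction; <-weakInduction-startingFrom)
open import Data.Product using (_,_; proj₁; proj₂)
open import Data.Sum using (inj₁; inj₂)
open import Relation.Nullary using (¬_; contradiction)
open import Relation.Binary.Definitions using (tri<; tri≈; tri>)
open import Relation.Binary.PropositionalEquality using (refl; sym; trans; cong; cong₂; subst; module ≡-Reasoning)
open import Relation.Binary.Structures using (IsStrictTotalOrder)
import Relation.Binary.Construct.StrictToNonStrict as StrictToNonStrict
open import Algebra.Bundles using (CommutativeRing)
import Algebra.Properties.AbelianGroup as AbelianGroupProperties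
import Algebra.Properties.CommutativeSemigroup as CommutativeSemigroupProperties

prefixCount-suc : ∀ {t} (w : Fin t → ℕ) (k : Fin t) →
                  prefixCount w (suc k) ≡ prefixCount w (inject₁ k) ℕ.+ w k
prefixCount-suc w zero = ℕ.+-comm (w zero) 0
prefixCount-suc {ℕ.suc t} w (suc k) =
  trans (cong (w zero ℕ.+_) (prefixCount-suc (λ j → w (suc j)) k))
        (sym (ℕ.+-assoc (w zero) _ _))

module OrderedFieldProperties (F : OrderedField) where
  open OrderedField F

  commutativeRing : CommutativeRing 0ℓ 0ℓ
  commutativeRing = record { isCommutativeRing = isCommutativeRing }

  open CommutativeRing commutativeRing
    using (+-assoc; +-identityˡ; +-identityʳ; -‿inverseʳ; +-abelianGroup; +-commutativeSemigroup)
  open AbelianGroupProperties +-abelianGroup using (ε⁻¹≈ε; //-rightDividesʳ; ⁻¹-∙-comm)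
  open CommutativeSemigroupProperties +-commutativeSemigroup using (interchange)
  open IsStrictTotalOrder isStrictTotalOrder
    using (compare; isEquivalence; <-resp-≈) renaming (trans to <-trans)
  open ≡-Reasoning

  ≤-trans : ∀ {a b d} → a ≤ b → b ≤ d → a ≤ d
  ≤-trans = StrictToNonStrict.trans _≡_ _<_ isEquivalence <-resp-≈ <-trans

  <-≤-trans : ∀ {a b d} → a < b → b ≤ d → a < d
  <-≤-trans = StrictToNonStrict.<-≤-trans _≡_ _<_ <-trans (proj₁ <-resp-≈)

  +-monoˡ-≤ : ∀ {a b} d → a ≤ b → a + d ≤ b + d
  +-monoˡ-≤ d (inj₁ a<b) = inj₁ (+-mono-< d a<b)
  +-monoˡ-≤ d (inj₂ refl) = inj₂ refl

  ≮⇒≥ : ∀ {a b} → ¬ (a < b) → b ≤ a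
  ≮⇒≥ {a} {b} a≮b with compare a b
  ... | tri< a<b _ _ = contradiction a<b a≮b
  ... | tri≈ _ a≡b _ = inj₂ (sym a≡b)
  ... | tri> _ _ b<a = inj₁ b<a

  a+b-b≡a : ∀ a b → (a + b) - b ≡ a
  a+b-b≡a a b = //-rightDividesʳ b a

  +-minus-interchange : ∀ a b d e → (a + b) - (d + e) ≡ (a - d) + (b - e)
  +-minus-interchange a b d e =
    trans (cong ((a + b) +_) (sym (⁻¹-∙-comm d e))) (interchange a b (- d) (- e))

  fromℕ-+ : ∀ m n → fromℕ (m ℕ.+ n) ≡ fromℕ m + fromℕ n
  fromℕ-+ m ℕ.zero = trans (cong fromℕ (ℕ.+-identityʳ m)) (sym (+-identityʳ (fromℕ m)))
  fromℕ-+ m (ℕ.suc n) = begin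
    fromℕ (m ℕ.+ ℕ.suc n)       ≡⟨ cong fromℕ (ℕ.+-suc m n) ⟩
    fromℕ (m ℕ.+ n) + 1#        ≡⟨ cong (_+ 1#) (fromℕ-+ m n) ⟩
    (fromℕ m + fromℕ n) + 1#    ≡⟨ +-assoc (fromℕ m) (fromℕ n) 1# ⟩
    fromℕ m + fromℕ (ℕ.suc n)   ∎

  fromℤ-⊖ : ∀ m n → fromℤ (m ⊖ n) ≡ fromℕ m - fromℕ n
  fromℤ-⊖ m ℕ.zero rewrite ℤ.⊖-≥ {m} {0} ℕ.z≤n =
    sym (trans (cong (fromℕ m +_) ε⁻¹≈ε) (+-identityʳ (fromℕ m)))
  fromℤ-⊖ ℕ.zero (ℕ.suc n) rewrite ℤ.⊖-≤ {0} {ℕ.suc n} ℕ.z≤n = sym (+-identityˡ _)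
  fromℤ-⊖ (ℕ.suc m) (ℕ.suc n) = begin
    fromℤ (ℕ.suc m ⊖ ℕ.suc n)               ≡⟨ cong fromℤ (ℤ.[1+m]⊖[1+n]≡m⊖n m n) ⟩
    fromℤ (m ⊖ n)                           ≡⟨ fromℤ-⊖ m n ⟩
    fromℕ m - fromℕ n                       ≡⟨ +-identityʳ _ ⟨
    (fromℕ m - fromℕ n) + 0#                ≡⟨ cong ((fromℕ m - fromℕ n) +_) (-‿inverseʳ 1#) ⟨
    (fromℕ m - fromℕ n) + (1# - 1#)         ≡⟨ +-minus-interchange (fromℕ m) 1# (fromℕ n) 1# ⟨
    fromℕ (ℕ.suc m) - fromℕ (ℕ.suc n)       ∎

  fromℤ-[+m]-[+n] : ∀ m n → fromℤ (ℤ.+ m ℤ.- ℤ.+ n) ≡ fromℕ m - fromℕ n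
  fromℤ-[+m]-[+n] m n = trans (cong fromℤ (ℤ.m-n≡m⊖n m n)) (fromℤ-⊖ m n)

module RepresentationProperties (F : OrderedField) {S : Types} {X : Set} {_≺_ : X → X → Set}
                                (ρ : Rep2 F S _≺_) where
  open OrderedField F
  open Rep2 ρ
  open OrderedFieldProperties F

  ≺⇒R≤c : ∀ {x y} → x ≺ y → R x ≤ c y
  ≺⇒R≤c {x} {y} x≺y with proj₁ (represents x y) x≺y
  ... | inj₁ Rx<cy = inj₁ Rx<cy
  ... | inj₂ (Rx≡cy , _) = inj₂ Rx≡cy

  ∥⇒c-1≤c : ∀ {x y} → Incomp _≺_ x y → c x - 1# ≤ c y
  ∥⇒c-1≤c {x} {y} (_ , _ , y⊀x) =
    subst (c x - 1# ≤_) (a+b-b≡a (c y) 1#) (+-monoˡ-≤ (- 1#) cx≤Ry)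
    where
      cx≤Ry : c x ≤ R y
      cx≤Ry = ≮⇒≥ (λ Ry<cx → y⊀x (proj₂ (represents y x) (inj₁ Ry<cx)))

  shift : ∀ {x y} → Step _≺_ x y → Carrier
  shift (up _) = 1#
  shift (side _) = - 1#

  c+shift≤c : ∀ {x y} (s : Step _≺_ x y) → c x + shift s ≤ c y
  c+shift≤c (up x≺y) = ≺⇒R≤c x≺y
  c+shift≤c (side x∥y) = ∥⇒c-1≤c x∥y

module TrailProperties (F : OrderedField) {S : Types} {X : Set} {_≺_ : X → X → Set}
                       (ρ : Rep2 F S _≺_) {t : ℕ} (T : Trail _≺_ t) where
  open OrderedField F
  open Rep2 ρ
  open Trail T
  open OrderedFieldProperties F
  open RepresentationProperties F ρ
  open CommutativeRing commutativeRing using (+-assoc; +-identityˡ; +-identityʳ; +-abelianGroup)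
  open AbelianGroupProperties +-abelianGroup using (ε⁻¹≈ε)
  open ≡-Reasoning

  isUp-isSide≡shift : ∀ k → fromℕ (isUp k) - fromℕ (isSide k) ≡ shift (step k)
  isUp-isSide≡shift k with step k
  ... | up _ = trans (cong ((0# + 1#) +_) ε⁻¹≈ε) (trans (+-identityʳ _) (+-identityˡ 1#))
  ... | side _ = trans (+-identityˡ _) (cong -_ (+-identityˡ 1#))

  val-suc : ∀ k → fromℤ (val (suc k)) ≡ fromℤ (val (inject₁ k)) + shift (step k)
  val-suc k = begin
    fromℤ (val (suc k))
      ≡⟨ fromℤ-[+m]-[+n] (upT (suc k)) (side' (suc k)) ⟩
    fromℕ (upT (suc k)) - fromℕ (side' (suc k))
      ≡⟨ cong₂ (λ u s → fromℕ u - fromℕ s) (prefixCount-suc isUp k) (prefixCount-suc isSide k) ⟩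
    fromℕ (upT k′ ℕ.+ isUp k) - fromℕ (side' k′ ℕ.+ isSide k)
      ≡⟨ cong₂ _-_ (fromℕ-+ (upT k′) (isUp k)) (fromℕ-+ (side' k′) (isSide k)) ⟩
    (fromℕ (upT k′) + fromℕ (isUp k)) - (fromℕ (side' k′) + fromℕ (isSide k))
      ≡⟨ +-minus-interchange (fromℕ (upT k′)) (fromℕ (isUp k)) (fromℕ (side' k′)) (fromℕ (isSide k)) ⟩
    (fromℕ (upT k′) - fromℕ (side' k′)) + (fromℕ (isUp k) - fromℕ (isSide k))
      ≡⟨ cong₂ _+_ (sym (fromℤ-[+m]-[+n] (upT k′) (side' k′))) (isUp-isSide≡shift k) ⟩
    fromℤ (val k′) + shift (step k)
      ∎
    where k′ = inject₁ k

  bound : Fin (ℕ.suc t) → Carrier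
  bound i = c (x zero) + fromℤ (val i)

  bound-suc : ∀ k → bound (suc k) ≡ bound (inject₁ k) + shift (step k)
  bound-suc k = trans (cong (c (x zero) +_) (val-suc k)) (sym (+-assoc _ _ _))

  bound≤c-suc : ∀ k → bound (inject₁ k) ≤ c (x (inject₁ k)) → bound (suc k) ≤ c (x (suc k))
  bound≤c-suc k b≤c = subst (_≤ c (x (suc k))) (sym (bound-suc k))
    (≤-trans (+-monoˡ-≤ (shift (step k)) b≤c) (c+shift≤c (step k)))

  bound<c-suc : ∀ k → bound (inject₁ k) < c (x (inject₁ k)) → bound (suc k) < c (x (suc k))
  bound<c-suc k b<c = subst (_< c (x (suc k))) (sym (bound-suc k))
    (<-≤-trans (+-mono-< (shift (step k)) b<c) (c+shift≤c (step k)))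

  bound≤c : ∀ i → bound i ≤ c (x i)
  bound≤c = <-weakInduction (λ i → bound i ≤ c (x i)) (inj₂ (+-identityʳ _)) bound≤c-suc

  bound<c-persists : ∀ i j → toℕ i ℕ.≤ toℕ j → bound i < c (x i) → bound j < c (x j)
  bound<c-persists i j i≤j b<c =
    <-weakInduction-startingFrom (λ j → bound j < c (x j)) b<c bound<c-suc i≤j

lemma7 : (F : OrderedField) (S : Types) → Nonempty S →
         {X : Set} (_≺_ : X → X → Set) → IsStrictPartialOrder _≡_ _≺_ →
         (ρ : Rep2 F S _≺_) → (t : ℕ) (T : Trail _≺_ t) →
         let open OrderedField F
             open Rep2 ρ
             open Trail T
         in ((i : Fin (ℕ.suc t)) → c (x zero) + fromℤ (val i) ≤ c (x i))
            × ((i j : Fin (ℕ.suc t)) → toℕ i Data.Nat.≤ toℕ j →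
                 c (x zero) + fromℤ (val i) < c (x i) →
                 c (x zero) + fromℤ (val j) < c (x j))
lemma7 F S _ _≺_ _ ρ t T = bound≤c , bound<c-persists
  where open TrailProperties F ρ T
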